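{- Let $M$ be the $2\times 4$ binary matrix whose top row is $(1,0,0,1)$ and whose bottom row is $(1,1,0,1)$. Then the polyomino class $Av_{\mathfrak{P}}(M)$ has an infinite $p$-basis, i.e. there are infinitely many polyominoes that contain $M$ as a submatrix and are minimal (for the submatrix order on polyominoes) with this property.
   Context: A polyomino is identified with the binary matrix of its minimal bounding rectangle (entry $1$ iff the corresponding cell is in the polyomino; the $1$s are edge-connected and the first/last rows and columns contain a $1$). $M'\preccurlyeq M$ if $M'$ is obtained from $M$ by deleting rows and/or columns. $Av_{\mathfrak{P}}(M)$ is the set of polyominoes not having $M$ as a submatrix; its $p$-basis is the set of $\preccurlyeq$-minimal polyominoes not in it. -}

module Defs where

open import Data.Nat using (ℕ; zero; suc; _+_; _∸_; _≤_)
open import Data.Fin as F using (Fin; toℕ)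
open import Data.Bool using (Bool; true; false)
open import Data.Vec using (Vec; []; _∷_; lookup)
open import Data.Product using (Σ; ∃; _×_; _,_)
open import Data.Sum using (_⊎_)
open import Relation.Binary.PropositionalEquality using (_≡_)
open import Relation.Nullary using (¬_)

record Matrix : Set where
  constructor mat
  field
    rows    : ℕ
    cols    : ℕ
    entries : Vec (Vec Bool cols) rows

open Matrix public

Cell : Matrix → Set
Cell A = Fin (rows A) × Fin (cols A)

entry : (A : Matrix) → Fin (rows A) → Fin (cols A) → Bool
entry A i j = lookup (lookup (entries A) i) j

One : (A : Matrix) → Cell A → Set
One A (i , j) = entry A i j ≡ true

Neighbour : ℕ → ℕ → Set
Neighbour a b = suc a ≡ b ⊎ suc b ≡ a

Adjacent : (A : Matrix) → Cell A → Cell A → Set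
Adjacent A (i , j) (i' , j') =
  (i ≡ i' × Neighbour (toℕ j) (toℕ j')) ⊎ (j ≡ j' × Neighbour (toℕ i) (toℕ i'))

data Reach (A : Matrix) (c : Cell A) : Cell A → Set where
  here : One A c → Reach A c c
  step : ∀ {d e} → Reach A c d → Adjacent A d e → One A e → Reach A c e

EdgeConnected : Matrix → Set
EdgeConnected A = ∀ c d → One A c → One A d → Reach A c d

record IsPolyomino (A : Matrix) : Set where
  field
    connected : EdgeConnected A
    firstRow  : ∃ λ (c : Cell A) → toℕ (Data.Product.proj₁ c) ≡ 0 × One A c
    lastRow   : ∃ λ (c : Cell A) → toℕ (Data.Product.proj₁ c) ≡ rows A ∸ 1 × One A c
    firstCol  : ∃ λ (c : Cell A) → toℕ (Data.Product.proj₂ c) ≡ 0 × One A c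
    lastCol   : ∃ λ (c : Cell A) → toℕ (Data.Product.proj₂ c) ≡ cols A ∸ 1 × One A c

StrictlyIncreasing : ∀ {m n} → (Fin m → Fin n) → Set
StrictlyIncreasing f = ∀ i j → i F.< j → f i F.< f j

_≼_ : Matrix → Matrix → Set
B ≼ A = Σ (Fin (rows B) → Fin (rows A)) λ f → Σ (Fin (cols B) → Fin (cols A)) λ g →
  StrictlyIncreasing f × StrictlyIncreasing g ×
  (∀ i j → entry B i j ≡ entry A (f i) (g j))

infix 4 _≼_

InAv : Matrix → Matrix → Set
InAv M P = IsPolyomino P × ¬ (M ≼ P)

InPBasis : Matrix → Matrix → Set
InPBasis M P =
  IsPolyomino P × (M ≼ P) ×
  (∀ Q → IsPolyomino Q → Q ≼ P → ¬ (Q ≡ P) → ¬ (M ≼ Q))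

M₀ : Matrix
M₀ = mat 2 4 ((true ∷ false ∷ false ∷ true ∷ []) ∷ (true ∷ true ∷ false ∷ true ∷ []) ∷ [])

module Submission where

-- The witnesses are the snakes S_h (h = n + 3): the h × (h+1) polyomino whose cells form a
-- single path, from (0,0) down column 1, up a staircase of width 2 to column h, and back
-- along row 0 to column 3. S_h contains M₀ exactly once, on rows 0, 1 and columns 0, 1, 2, h.
-- A polyomino Q ≼ S_h containing M₀ therefore keeps these rows and columns. If Q also missed
-- a row x ≥ 2 (resp. a column 3 ≤ y < h), consider the region "column ≤ 2 or below row x"
-- (resp. "column ≤ 2, or row ≥ 2 and left of column y"): it contains (0,0) but not (0,h),
-- and any two cells of S_h in a common row or column, one inside and one outside, lie on
-- both sides of column 2 or of row 1. As Q keeps row 1 and column 2, no two adjacent cells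
-- of Q cross the region's border, so Q is not connected. Hence Q = S_h.

open import Defs
open import Data.Bool using (Bool; true; _∨_; T)
open import Data.Bool.Properties using (T-∨; T-≡)
open import Data.Empty using (⊥; ⊥-elim)
open import Data.Fin as F using (Fin; zero; suc; toℕ; fromℕ; fromℕ<)
open import Data.Fin.Properties using (toℕ<n; toℕ-fromℕ; toℕ-fromℕ<; toℕ-injective; all?; any?)
open import Data.Nat
  using (ℕ; zero; suc; _+_; _∸_; _≤_; _<_; z≤n; s≤s; s≤s⁻¹; z<s; _≡ᵇ_; _≤ᵇ_; _≟_; _≤?_; _<?_)
open import Data.Nat.Properties
open import Data.Product using (∃; _×_; _,_; proj₁; proj₂)
open import Data.Sum using (_⊎_; inj₁; inj₂; [_,_]′)
open import Data.Vec using (Vec; lookup; tabulate)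
open import Data.Vec.Properties using (lookup∘tabulate; tabulate∘lookup; tabulate-cong)
open import Function using (_∘_; id)
open import Function.Bundles using (Equivalence)
open import Relation.Binary.Definitions using (tri<; tri≈; tri>)
open import Relation.Binary.PropositionalEquality
open import Relation.Nullary using (¬_; Dec; yes; no; contradiction)
open import Relation.Nullary.Decidable using (from-yes; decidable-stable; _⊎-dec_; _×-dec_; _→-dec_)

open Equivalence using (to; from)

private
  variable
    A B C : Matrix
    m k r r′ c c′ u v x y c₁ c₂ c₃ c₄ : ℕ

Neighbour-sym : Neighbour x y → Neighbour y x
Neighbour-sym (inj₁ e) = inj₂ e
Neighbour-sym (inj₂ e) = inj₁ e

Adjacent-sym : ∀ {d e : Cell A} → Adjacent A d e → Adjacent A e d
Adjacent-sym {d = _ , _} {_ , _} (inj₁ (i≡i′ , j~j′)) = inj₁ (sym i≡i′ , Neighbour-sym j~j′)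
Adjacent-sym {d = _ , _} {_ , _} (inj₂ (j≡j′ , i~i′)) = inj₂ (sym j≡j′ , Neighbour-sym i~i′)

Reach⇒One : ∀ {d e : Cell A} → Reach A d e → One A e
Reach⇒One (here one) = one
Reach⇒One (step _ _ one) = one

Reach-trans : ∀ {d e e′ : Cell A} → Reach A d e → Reach A e e′ → Reach A d e′
Reach-trans d⇝e (here _) = d⇝e
Reach-trans d⇝e (step e⇝e″ adj one) = step (Reach-trans d⇝e e⇝e″) adj one

Reach-sym : ∀ {d e : Cell A} → Reach A d e → Reach A e d
Reach-sym (here one) = here one
Reach-sym {A = A} (step d⇝e″ adj one) =
  Reach-trans (step (here one) (Adjacent-sym {A} adj) (Reach⇒One d⇝e″)) (Reach-sym d⇝e″)

Reach-preserves : (R : Cell A → Set) →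
                  (∀ {d e} → One A d → One A e → Adjacent A d e → R d → R e) →
                  ∀ {d e} → Reach A d e → R d → R e
Reach-preserves R closed (here _) Rd = Rd
Reach-preserves R closed (step d⇝e″ adj one) Rd =
  closed (Reach⇒One d⇝e″) one adj (Reach-preserves R closed d⇝e″ Rd)

≼-trans : A ≼ B → B ≼ C → A ≼ C
≼-trans (f , g , f↑ , g↑ , A≗B) (f′ , g′ , f′↑ , g′↑ , B≗C) =
  f′ ∘ f , g′ ∘ g ,
  (λ i j i<j → f′↑ _ _ (f↑ i j i<j)) , (λ i j i<j → g′↑ _ _ (g↑ i j i<j)) ,
  λ i j → trans (A≗B i j) (B≗C (f i) (g j))

StrictlyIncreasing? : (f : Fin m → Fin k) → Dec (StrictlyIncreasing f)
StrictlyIncreasing? f = all? λ i → all? λ j → (i F.<? j) →-dec (f i F.<? f j)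

Onto : (Fin m → Fin k) → Set
Onto {k = k} f = ∀ x → x < k → ∃ λ i → toℕ (f i) ≡ x

module _ {f : Fin m → Fin k} (f↑ : StrictlyIncreasing f) where

  StrictlyIncreasing-reflects : ∀ i j → f i F.< f j → i F.< j
  StrictlyIncreasing-reflects i j fi<fj with <-cmp (toℕ i) (toℕ j)
  ... | tri< i<j _ _ = i<j
  ... | tri≈ _ i≡j _ = ⊥-elim (<-irrefl (cong (toℕ ∘ f) (toℕ-injective i≡j)) fi<fj)
  ... | tri> _ _ j<i = ⊥-elim (<-asym fi<fj (f↑ j i j<i))

  no-value-between : ∀ {i j} t → Neighbour (toℕ i) (toℕ j) → f i F.< f t → f t F.< f j → ⊥
  no-value-between {i} {j} t i~j fi<ft ft<fj = squeezed i~j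
    where
    i<t : i F.< t
    i<t = StrictlyIncreasing-reflects i t fi<ft
    t<j : t F.< j
    t<j = StrictlyIncreasing-reflects t j ft<fj
    squeezed : Neighbour (toℕ i) (toℕ j) → ⊥
    squeezed (inj₁ 1+i≡j) = <⇒≱ i<t (s≤s⁻¹ (subst (toℕ t <_) (sym 1+i≡j) t<j))
    squeezed (inj₂ 1+j≡i) = <-asym (<-trans i<t t<j) (≤-reflexive 1+j≡i)

  module _ (onto : Onto f) where

    -- Onto means no gaps: f takes the value 0, and f (i + 1) = f i + 1.
    private
      fixes : ∀ x i → toℕ i ≡ x → toℕ (f i) ≡ x
      fixes zero i i≡0 = n≤0⇒n≡0 (≮⇒≥ λ 0<fi →
        let (j , fj≡0) = onto 0 (<-trans 0<fi (toℕ<n (f i)))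
        in  n≮0 (subst (toℕ j <_) i≡0
              (StrictlyIncreasing-reflects j i (subst (_< toℕ (f i)) (sym fj≡0) 0<fi))))
      fixes (suc x) i i≡1+x = ≤-antisym (≮⇒≥ no-gap) fi′<fi
        where
        x<m : x < m
        x<m = <⇒≤ (subst (_< m) i≡1+x (toℕ<n i))
        i′ : Fin m
        i′ = fromℕ< x<m
        fi′≡x : toℕ (f i′) ≡ x
        fi′≡x = fixes x i′ (toℕ-fromℕ< x<m)
        1+i′≡i : suc (toℕ i′) ≡ toℕ i
        1+i′≡i = trans (cong suc (toℕ-fromℕ< x<m)) (sym i≡1+x)
        fi′<fi : suc x ≤ toℕ (f i)
        fi′<fi = subst (_< toℕ (f i)) fi′≡x (f↑ i′ i (≤-reflexive 1+i′≡i))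
        no-gap : ¬ (suc x < toℕ (f i))
        no-gap 1+x<fi =
          let (t , ft≡1+x) = onto (suc x) (<-trans 1+x<fi (toℕ<n (f i)))
          in  no-value-between t (inj₁ 1+i′≡i) (subst₂ _<_ (sym fi′≡x) (sym ft≡1+x) (n<1+n x))
                                            (subst (_< toℕ (f i)) (sym ft≡1+x) 1+x<fi)

    Onto⇒fixes : ∀ i → toℕ (f i) ≡ toℕ i
    Onto⇒fixes i = fixes (toℕ i) i refl

    Onto⇒≡ : m ≡ k
    Onto⇒≡ = ≤-antisym (≮⇒≥ k≮m) (≮⇒≥ m≮k)
      where
      k≮m : ¬ (k < m)
      k≮m k<m = <-irrefl (trans (Onto⇒fixes (fromℕ< k<m)) (toℕ-fromℕ< k<m)) (toℕ<n (f (fromℕ< k<m)))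
      m≮k : ¬ (m < k)
      m≮k m<k = let (t , ft≡m) = onto m m<k in <-irrefl (trans (sym (Onto⇒fixes t)) ft≡m) (toℕ<n t)

Vec-ext : ∀ {X : Set} {xs ys : Vec X m} → (∀ i → lookup xs i ≡ lookup ys i) → xs ≡ ys
Vec-ext {xs = xs} {ys} eq = trans (sym (tabulate∘lookup xs)) (trans (tabulate-cong eq) (tabulate∘lookup ys))

≼-onto⇒≡ : (B≼A : B ≼ A) → let (f , g , _) = B≼A in Onto f → Onto g → B ≡ A
≼-onto⇒≡ {mat m k e} {mat _ _ e′} (f , g , f↑ , g↑ , same) f-onto g-onto
  with Onto⇒≡ f↑ f-onto | Onto⇒≡ g↑ g-onto
... | refl | refl = cong (mat m k) (Vec-ext λ i → Vec-ext λ j →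
  trans (same i j) (cong₂ (entry (mat m k e′)) (toℕ-injective (Onto⇒fixes f↑ f-onto i))
                                               (toℕ-injective (Onto⇒fixes g↑ g-onto j))))

module Snake (n : ℕ) where

  h : ℕ
  h = 3 + n

  3≤h : 3 ≤ h
  3≤h = s≤s (s≤s (s≤s z≤n))

  -- The cells of S_h; for h = 5:
  --   1 0 0 1 1 1
  --   1 1 0 0 0 1
  --   0 1 0 0 1 1
  --   0 1 0 1 1 0
  --   0 1 1 1 0 0
  data Occupied : ℕ → ℕ → Set where
    corner : Occupied 0 0
    top    : 3 ≤ c → Occupied 0 c
    left   : Occupied 1 0
    elbow  : Occupied 1 1
    right  : Occupied 1 h
    spine  : 2 ≤ r → Occupied r 1
    stair₁ : 2 ≤ r → c + r ≡ suc h → Occupied r c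
    stair₂ : 2 ≤ r → c + r ≡ 2 + h → Occupied r c

  snake-entry : ℕ → ℕ → Bool
  snake-entry 0 c = (c ≡ᵇ 0) ∨ (3 ≤ᵇ c)
  snake-entry 1 c = (c ≡ᵇ 0) ∨ (c ≡ᵇ 1) ∨ (c ≡ᵇ h)
  snake-entry r@(suc (suc _)) c = (c ≡ᵇ 1) ∨ (c + r ≡ᵇ suc h) ∨ (c + r ≡ᵇ 2 + h)

  T⇒Occupied : ∀ r c → T (snake-entry r c) → Occupied r c
  T⇒Occupied 0 c t with to T-∨ t
  ... | inj₁ c≡0 = subst (Occupied 0) (sym (≡ᵇ⇒≡ c 0 c≡0)) corner
  ... | inj₂ 3≤c = top (≤ᵇ⇒≤ 3 c 3≤c)
  T⇒Occupied 1 c t with to T-∨ t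
  ... | inj₁ c≡0 = subst (Occupied 1) (sym (≡ᵇ⇒≡ c 0 c≡0)) left
  ... | inj₂ t′ with to T-∨ t′
  ...   | inj₁ c≡1 = subst (Occupied 1) (sym (≡ᵇ⇒≡ c 1 c≡1)) elbow
  ...   | inj₂ c≡h = subst (Occupied 1) (sym (≡ᵇ⇒≡ c h c≡h)) right
  T⇒Occupied r@(suc (suc _)) c t with to T-∨ t
  ... | inj₁ c≡1 = subst (Occupied r) (sym (≡ᵇ⇒≡ c 1 c≡1)) (spine (s≤s (s≤s z≤n)))
  ... | inj₂ t′ with to T-∨ t′
  ...   | inj₁ e = stair₁ (s≤s (s≤s z≤n)) (≡ᵇ⇒≡ _ _ e)
  ...   | inj₂ e = stair₂ (s≤s (s≤s z≤n)) (≡ᵇ⇒≡ _ _ e)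

  Occupied⇒T : Occupied r c → T (snake-entry r c)
  Occupied⇒T corner = _
  Occupied⇒T (top {c} 3≤c) = from (T-∨ {c ≡ᵇ 0}) (inj₂ (≤⇒≤ᵇ 3≤c))
  Occupied⇒T left = _
  Occupied⇒T elbow = _
  Occupied⇒T right = from (T-∨ {h ≡ᵇ 0}) (inj₂ (from (T-∨ {h ≡ᵇ 1}) (inj₂ (≡⇒≡ᵇ h h refl))))
  Occupied⇒T (spine {suc (suc _)} _) = _
  Occupied⇒T (stair₁ {r@(suc (suc _))} {c} _ e) =
    from (T-∨ {c ≡ᵇ 1}) (inj₂ (from (T-∨ {c + r ≡ᵇ suc h}) (inj₁ (≡⇒≡ᵇ _ _ e))))
  Occupied⇒T (stair₂ {r@(suc (suc _))} {c} _ e) =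
    from (T-∨ {c ≡ᵇ 1}) (inj₂ (from (T-∨ {c + r ≡ᵇ suc h}) (inj₂ (≡⇒≡ᵇ _ _ e))))
  Occupied⇒T (spine {1} (s≤s ()))
  Occupied⇒T (stair₁ {1} (s≤s ()) _)
  Occupied⇒T (stair₂ {1} (s≤s ()) _)

  snake : Matrix
  snake = mat h (suc h) (tabulate λ i → tabulate λ j → snake-entry (toℕ i) (toℕ j))

  entry-snake : ∀ i j → entry snake i j ≡ snake-entry (toℕ i) (toℕ j)
  entry-snake i j =
    trans (cong (λ row → lookup row j) (lookup∘tabulate (λ i → tabulate λ j → snake-entry (toℕ i) (toℕ j)) i))
          (lookup∘tabulate (λ j → snake-entry (toℕ i) (toℕ j)) j)

  One⇒Occupied : ∀ {i j} → One snake (i , j) → Occupied (toℕ i) (toℕ j)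
  One⇒Occupied {i} {j} one = T⇒Occupied _ _ (from T-≡ (trans (sym (entry-snake i j)) one))

  Occupied⇒One : ∀ {i j} → Occupied (toℕ i) (toℕ j) → One snake (i , j)
  Occupied⇒One {i} {j} o = trans (entry-snake i j) (to T-≡ (Occupied⇒T o))

  One-at : ∀ {i j} → toℕ i ≡ r → toℕ j ≡ c → Occupied r c → One snake (i , j)
  One-at refl refl = Occupied⇒One

  row1-occupied : Occupied 1 c → c ≤ 1 ⊎ c ≡ h
  row1-occupied left = inj₁ z≤n
  row1-occupied elbow = inj₁ ≤-refl
  row1-occupied right = inj₂ refl
  row1-occupied (spine (s≤s ()))
  row1-occupied (stair₁ (s≤s ()) _)
  row1-occupied (stair₂ (s≤s ()) _)

  row1-right : Occupied 1 c → 2 ≤ c → c ≡ h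
  row1-right o 2≤c with row1-occupied o
  ... | inj₁ c≤1 = ⊥-elim (<⇒≱ 2≤c c≤1)
  ... | inj₂ c≡h = c≡h

  column0-occupied : Occupied r 0 → r < h → r ≤ 1
  column0-occupied corner _ = z≤n
  column0-occupied (top ())
  column0-occupied left _ = ≤-refl
  column0-occupied (stair₁ _ r≡1+h) r<h = ⊥-elim (<⇒≱ r<h (subst (h ≤_) (sym r≡1+h) (m≤n+m h 1)))
  column0-occupied (stair₂ _ r≡2+h) r<h = ⊥-elim (<⇒≱ r<h (subst (h ≤_) (sym r≡2+h) (m≤n+m h 2)))

  column2-occupied : Occupied r 2 → 2 ≤ r × h ≤ suc r
  column2-occupied (top (s≤s (s≤s ())))
  column2-occupied (stair₁ 2≤r e) = 2≤r , ≤-reflexive (sym (suc-injective e))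
  column2-occupied (stair₂ 2≤r e) =
    2≤r , ≤-trans (≤-reflexive (sym (suc-injective (suc-injective e)))) (n≤1+n _)

  stair-band : 2 ≤ r → 2 ≤ c → Occupied r c → suc h ≤ c + r × c + r ≤ 2 + h
  stair-band _ _ (stair₁ _ e) = ≤-reflexive (sym e) , ≤-trans (≤-reflexive e) (n≤1+n _)
  stair-band _ _ (stair₂ _ e) = ≤-trans (n≤1+n _) (≤-reflexive (sym e)) , ≤-reflexive e
  stair-band () _ corner
  stair-band () _ (top _)
  stair-band (s≤s ()) _ left
  stair-band (s≤s ()) _ elbow
  stair-band (s≤s ()) _ right
  stair-band _ (s≤s ()) (spine _)

  stair-step : 2 ≤ r → 2 ≤ c → 2 ≤ r′ → 2 ≤ c′ → Occupied r c → Occupied r′ c′ →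
               c′ + r′ ≤ suc (c + r)
  stair-step 2≤r 2≤c 2≤r′ 2≤c′ o o′ =
    ≤-trans (proj₂ (stair-band 2≤r′ 2≤c′ o′)) (s≤s (proj₁ (stair-band 2≤r 2≤c o)))

  row-stair-adjacent : 2 ≤ r → 2 ≤ c → Occupied r c → Occupied r c′ → c′ ≤ suc c
  row-stair-adjacent {r} {c} {c′} 2≤r 2≤c o o′ with 2 ≤? c′
  ... | yes 2≤c′ = +-cancelʳ-≤ r c′ (suc c) (stair-step 2≤r 2≤c 2≤r 2≤c′ o o′)
  ... | no  2≰c′ = ≤-trans (s≤s⁻¹ (≰⇒> 2≰c′)) (s≤s z≤n)

  column-stair-adjacent : 2 ≤ r → 2 ≤ c → Occupied r c → Occupied r′ c → r′ ≤ suc r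
  column-stair-adjacent {r} {c} {r′} 2≤r 2≤c o o′ with 2 ≤? r′
  ... | yes 2≤r′ =
    +-cancelˡ-≤ c r′ (suc r) (subst (c + r′ ≤_) (sym (+-suc c r)) (stair-step 2≤r 2≤c 2≤r′ 2≤c o o′))
  ... | no  2≰r′ = ≤-trans (s≤s⁻¹ (≰⇒> 2≰r′)) (s≤s z≤n)

  last-column-occupied : Occupied r h → r ≤ 2
  last-column-occupied {r} o with 2 ≤? r
  ... | yes 2≤r = +-cancelˡ-≤ h r 2 (subst (h + r ≤_) (+-comm 2 h) (proj₂ (stair-band 2≤r (<⇒≤ 3≤h) o)))
  ... | no  2≰r = ≤-trans (s≤s⁻¹ (≰⇒> 2≰r)) (s≤s z≤n)

  stair-column : c + r ≡ suc h → r < h → 2 ≤ c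
  stair-column {c} {r} e r<h = +-cancelʳ-≤ r 2 c (subst (2 + r ≤_) (sym e) (s≤s r<h))

  origin : Cell snake
  origin = zero , zero

  -- Vacuous outside the h × (h + 1) rectangle, so only the moves left and up need bounds.
  ReachableAt : ℕ → ℕ → Set
  ReachableAt r c = ∀ {i j} → toℕ i ≡ r → toℕ j ≡ c → Reach snake origin (i , j)

  move-right : ReachableAt r c → Occupied r (suc c) → ReachableAt r (suc c)
  move-right {c = c} reach o {j = j} i≡r j≡1+c =
    step (reach i≡r (toℕ-fromℕ< c<1+h))
         (inj₁ (refl , inj₁ (trans (cong suc (toℕ-fromℕ< c<1+h)) (sym j≡1+c))))
         (One-at i≡r j≡1+c o)
    where
    c<1+h : c < suc h
    c<1+h = <⇒≤ (subst (_< suc h) j≡1+c (toℕ<n j))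

  move-left : c < h → ReachableAt r (suc c) → Occupied r c → ReachableAt r c
  move-left c<h reach o i≡r j≡c =
    step (reach i≡r (toℕ-fromℕ< (s≤s c<h)))
         (inj₁ (refl , inj₂ (trans (cong suc j≡c) (sym (toℕ-fromℕ< (s≤s c<h))))))
         (One-at i≡r j≡c o)

  move-down : ReachableAt r c → Occupied (suc r) c → ReachableAt (suc r) c
  move-down {r = r} reach o {i = i} i≡1+r j≡c =
    step (reach (toℕ-fromℕ< r<h) j≡c)
         (inj₂ (refl , inj₁ (trans (cong suc (toℕ-fromℕ< r<h)) (sym i≡1+r))))
         (One-at i≡1+r j≡c o)
    where
    r<h : r < h
    r<h = <⇒≤ (subst (_< h) i≡1+r (toℕ<n i))

  move-up : suc r < h → ReachableAt (suc r) c → Occupied r c → ReachableAt r c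
  move-up 1+r<h reach o i≡r j≡c =
    step (reach (toℕ-fromℕ< 1+r<h) j≡c)
         (inj₂ (refl , inj₂ (trans (cong suc i≡r) (sym (toℕ-fromℕ< 1+r<h)))))
         (One-at i≡r j≡c o)

  reach-origin : ReachableAt 0 0
  reach-origin {zero} {zero} _ _ = here (Occupied⇒One corner)
  reach-origin {zero} {suc _} _ ()
  reach-origin {suc _} ()

  reach-spine : ∀ r → ReachableAt (suc r) 1
  reach-spine zero = move-right (move-down reach-origin left) elbow
  reach-spine (suc r) = move-down (reach-spine r) (spine (s≤s (s≤s z≤n)))

  reach-stair : ∀ c → 2 ≤ c → 2 ≤ r → c + r ≡ suc h → ReachableAt r c × ReachableAt r (suc c)
  reach-stair {r} 2 _ _ e rewrite suc-injective (suc-injective e) =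
    let at2 = move-right (reach-spine (suc n)) (stair₁ (s≤s (s≤s z≤n)) refl)
    in  at2 , move-right at2 (stair₂ (s≤s (s≤s z≤n)) refl)
  reach-stair {r} (suc c@(suc (suc _))) _ 2≤r e =
    let atc = move-up 1+r<h (proj₂ (reach-stair c 2≤c (≤-trans 2≤r (n≤1+n r)) e′)) (stair₁ 2≤r e)
    in  atc , move-right atc (stair₂ 2≤r (cong suc e))
    where
    2≤c : 2 ≤ c
    2≤c = s≤s (s≤s z≤n)
    e′ : c + suc r ≡ suc h
    e′ = trans (+-suc c r) e
    1+r<h : suc r < h
    1+r<h = s≤s⁻¹ (subst (2 + suc r ≤_) e′ (+-monoˡ-≤ (suc r) 2≤c))
  reach-stair 1 (s≤s ()) _ _

  reach-right : ReachableAt 1 h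
  reach-right = move-up 3≤h
    (proj₂ (reach-stair (2 + n) (s≤s (s≤s z≤n)) (s≤s (s≤s z≤n)) (+-comm (2 + n) 2))) right

  reach-top : ∀ d → 3 ≤ c → c + d ≡ h → ReachableAt 0 c
  reach-top {c} zero _ c+0≡h =
    subst (ReachableAt 0) (sym (trans (sym (+-identityʳ c)) c+0≡h))
      (move-up (s≤s (s≤s z≤n)) reach-right (top 3≤h))
  reach-top {c} (suc d) 3≤c e = move-left c<h (reach-top d (≤-trans 3≤c (n≤1+n c)) e′) (top 3≤c)
    where
    e′ : suc c + d ≡ h
    e′ = trans (sym (+-suc c d)) e
    c<h : c < h
    c<h = subst (suc c ≤_) e′ (m≤m+n (suc c) d)

  reachable : ∀ {i j} → Occupied (toℕ i) (toℕ j) → Reach snake origin (i , j)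
  reachable {i} {j} o = reach (toℕ<n i) (toℕ<n j) o refl refl
    where
    reach : r < h → c < suc h → Occupied r c → ReachableAt r c
    reach _ _ corner = reach-origin
    reach _ c<1+h (top {c} 3≤c) = reach-top (h ∸ c) 3≤c (m+[n∸m]≡n (s≤s⁻¹ c<1+h))
    reach _ _ left = move-down reach-origin left
    reach _ _ elbow = reach-spine 0
    reach _ _ right = reach-right
    reach _ _ (spine {suc r} _) = reach-spine r
    reach r<h _ (stair₁ 2≤r e) = proj₁ (reach-stair _ (stair-column e r<h) 2≤r e)
    reach r<h _ (stair₂ {c = zero} _ r≡2+h) = ⊥-elim (<⇒≱ r<h (subst (h ≤_) (sym r≡2+h) (m≤n+m h 2)))
    reach r<h _ (stair₂ {c = suc c} 2≤r e) =
      proj₂ (reach-stair c (stair-column (suc-injective e) r<h) 2≤r (suc-injective e))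

  snake-isPolyomino : IsPolyomino snake
  snake-isPolyomino = record
    { connected = λ _ _ o o′ →
        Reach-trans (Reach-sym (reachable (One⇒Occupied o))) (reachable (One⇒Occupied o′))
    ; firstRow  = origin , refl , Occupied⇒One corner
    ; lastRow   = (fromℕ (2 + n) , suc zero) , toℕ-fromℕ (2 + n) ,
                  One-at (toℕ-fromℕ (2 + n)) refl (spine (s≤s (s≤s z≤n)))
    ; firstCol  = origin , refl , Occupied⇒One corner
    ; lastCol   = (zero , fromℕ h) , toℕ-fromℕ h , One-at refl (toℕ-fromℕ h) (top 3≤h)
    }

  standard-rows : Fin 2 → Fin h
  standard-rows zero = zero
  standard-rows (suc _) = suc zero

  standard-columns : Fin 4 → Fin (suc h)
  standard-columns zero = zero
  standard-columns (suc zero) = suc zero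
  standard-columns (suc (suc zero)) = suc (suc zero)
  standard-columns (suc (suc (suc _))) = fromℕ h

  M₀≼snake : M₀ ≼ snake
  M₀≼snake = standard-rows , standard-columns ,
             from-yes (StrictlyIncreasing? standard-rows) , from-yes (StrictlyIncreasing? standard-columns) ,
             same-entries
    where
    same-entries : ∀ a b → entry M₀ a b ≡ entry snake (standard-rows a) (standard-columns b)
    same-entries zero zero = refl
    same-entries zero (suc zero) = refl
    same-entries zero (suc (suc zero)) = refl
    same-entries zero (suc (suc (suc zero))) = sym (One-at refl (toℕ-fromℕ h) (top 3≤h))
    same-entries (suc zero) zero = refl
    same-entries (suc zero) (suc zero) = refl
    same-entries (suc zero) (suc (suc zero)) = refl
    same-entries (suc zero) (suc (suc (suc zero))) = sym (One-at refl (toℕ-fromℕ h) right)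

  M₀-position : u < v → v < h → c₁ < c₂ → c₂ < c₃ → c₃ < c₄ →
                Occupied v c₁ → Occupied v c₂ → Occupied v c₄ → ¬ Occupied u c₃ →
                u ≡ 0 × v ≡ 1 × c₁ ≡ 0 × c₂ ≡ 1 × c₃ ≡ 2 × c₄ ≡ h
  M₀-position {zero} {suc zero} {_} {c₂} {c₃} {c₄} _ _ c₁<c₂ c₂<c₃ c₃<c₄ _ o₂ o₄ ¬o₃ =
    refl , refl , n<1⇒n≡0 (<-≤-trans c₁<c₂ c₂≤1) , c₂≡1 ,
    ≤-antisym (s≤s⁻¹ (≰⇒> (¬o₃ ∘ top))) 2≤c₃ , c₄≡h
    where
    2≤c₃ : 2 ≤ c₃
    2≤c₃ = ≤-trans (s≤s (≤-trans (s≤s z≤n) c₁<c₂)) c₂<c₃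
    c₄≡h : c₄ ≡ h
    c₄≡h = row1-right o₄ (≤-trans 2≤c₃ (<⇒≤ c₃<c₄))
    c₂≤1 : c₂ ≤ 1
    c₂≤1 with row1-occupied o₂
    ... | inj₁ c₂≤1 = c₂≤1
    ... | inj₂ c₂≡h = ⊥-elim (<-irrefl (trans c₂≡h (sym c₄≡h)) (<-trans c₂<c₃ c₃<c₄))
    c₂≡1 : c₂ ≡ 1
    c₂≡1 = ≤-antisym c₂≤1 (≤-trans (s≤s z≤n) c₁<c₂)
  M₀-position {suc _} {suc zero} (s≤s ())
  -- For v ≥ 2, right of column 1 row v has at most two cells, and they are adjacent: no room for c₃.
  M₀-position {v = suc (suc _)} {c₁ = zero} _ v<h _ _ _ o₁ _ _ _ with column0-occupied o₁ v<h
  ... | s≤s ()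
  M₀-position {v = suc (suc _)} {c₁ = suc _} _ _ c₁<c₂ c₂<c₃ c₃<c₄ _ o₂ o₄ _ =
    ⊥-elim (<⇒≱ (≤-<-trans c₂<c₃ c₃<c₄)
                (row-stair-adjacent (s≤s (s≤s z≤n)) (≤-trans (s≤s (s≤s z≤n)) c₁<c₂) o₂ o₄))

  M₀-occurrence-unique : (occ : M₀ ≼ snake) →
                         let (F , G , _) = occ in F ≗ standard-rows × G ≗ standard-columns
  M₀-occurrence-unique (F , G , F↑ , G↑ , same-entries) =
    let (u≡0 , v≡1 , c₁≡0 , c₂≡1 , c₃≡2 , c₄≡h) =
          M₀-position (F↑ zero (suc zero) z<s) (toℕ<n (F (suc zero)))
                      (G↑ zero (suc zero) z<s) (G↑ (suc zero) (suc (suc zero)) (s≤s z<s))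
                      (G↑ (suc (suc zero)) (suc (suc (suc zero))) (s≤s (s≤s z<s)))
                      (occupied-at (suc zero) zero refl) (occupied-at (suc zero) (suc zero) refl)
                      (occupied-at (suc zero) (suc (suc (suc zero))) refl)
                      (λ o → contradiction (trans (same-entries zero (suc (suc zero))) (Occupied⇒One o)) λ ())
    in  (λ { zero → toℕ-injective u≡0 ; (suc zero) → toℕ-injective v≡1 }) ,
        (λ { zero → toℕ-injective c₁≡0
           ; (suc zero) → toℕ-injective c₂≡1
           ; (suc (suc zero)) → toℕ-injective c₃≡2
           ; (suc (suc (suc zero))) → toℕ-injective (trans c₄≡h (sym (toℕ-fromℕ h))) })
    where
    occupied-at : ∀ a b → entry M₀ a b ≡ true → Occupied (toℕ (F a)) (toℕ (G b))
    occupied-at a b one = One⇒Occupied (trans (sym (same-entries a b)) one)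

  LeftOrBelow : ℕ → ℕ → ℕ → Set
  LeftOrBelow x r c = c ≤ 2 ⊎ x < r

  LeftOrBefore : ℕ → ℕ → ℕ → Set
  LeftOrBefore y r c = c ≤ 2 ⊎ (2 ≤ r × c < y)

  distant-in-column⇒row0 : 2 < c → Occupied r′ c → Occupied r c → suc r′ < r → 2 < r → r′ ≡ 0
  distant-in-column⇒row0 {r′ = zero} _ _ _ _ _ = refl
  distant-in-column⇒row0 {r′ = suc zero} 2<c o′ o _ 2<r =
    ⊥-elim (<⇒≱ 2<r (last-column-occupied (subst (Occupied _) (row1-right o′ (<⇒≤ 2<c)) o)))
  distant-in-column⇒row0 {r′ = suc (suc _)} 2<c o′ o 1+r′<r _ =
    ⊥-elim (<⇒≱ 1+r′<r (column-stair-adjacent (s≤s (s≤s z≤n)) (<⇒≤ 2<c) o′ o))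

  LeftOrBelow-exit-horizontal : x < h → Occupied r c → Occupied r c′ → r ≢ x →
                                LeftOrBelow x r c → ¬ LeftOrBelow x r c′ → c < 2 × 2 < c′
  LeftOrBelow-exit-horizontal {x} {r} {c} x<h o _ r≢x inside outside =
    ≤∧≢⇒< c≤2 c≢2 , ≰⇒> (outside ∘ inj₁)
    where
    r<x : r < x
    r<x = ≤∧≢⇒< (≮⇒≥ (outside ∘ inj₂)) r≢x
    c≤2 : c ≤ 2
    c≤2 = [ id , (λ x<r → ⊥-elim (<-asym r<x x<r)) ]′ inside
    c≢2 : c ≢ 2
    c≢2 c≡2 = <⇒≱ (≤-trans (s≤s r<x) x<h) (proj₂ (column2-occupied (subst (Occupied r) c≡2 o)))

  LeftOrBelow-exit-vertical : 2 ≤ x → Occupied r c → Occupied r′ c → r′ ≢ x →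
                              LeftOrBelow x r c → ¬ LeftOrBelow x r′ c → r′ < 1 × 1 < r
  LeftOrBelow-exit-vertical {x} {r} {c} {r′} 2≤x o o′ r′≢x inside outside =
    subst (_< 1) (sym r′≡0) z<s , <-trans 2≤x x<r
    where
    2<c : 2 < c
    2<c = ≰⇒> (outside ∘ inj₁)
    x<r : x < r
    x<r = [ (λ c≤2 → ⊥-elim (<⇒≱ 2<c c≤2)) , id ]′ inside
    r′≡0 : r′ ≡ 0
    r′≡0 = distant-in-column⇒row0 2<c o′ o (≤-<-trans (≤∧≢⇒< (≮⇒≥ (outside ∘ inj₂)) r′≢x) x<r)
                                           (≤-<-trans 2≤x x<r)

  LeftOrBefore-exit-horizontal : 3 ≤ y → Occupied r c → Occupied r c′ → c′ ≢ y →
                                 LeftOrBefore y r c → ¬ LeftOrBefore y r c′ → c < 2 × 2 < c′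
  LeftOrBefore-exit-horizontal {y} {r} {c} {c′} 3≤y o o′ c′≢y inside outside =
    ≰⇒> 2≰c , ≰⇒> (outside ∘ inj₁)
    where
    on-stair : 2 ≤ c → 2 ≤ r × c < y
    on-stair 2≤c =
      [ (λ c≤2 → proj₁ (column2-occupied (subst (Occupied r) (≤-antisym c≤2 2≤c) o)) , ≤-<-trans c≤2 3≤y)
      , id ]′ inside
    2≰c : ¬ 2 ≤ c
    2≰c 2≤c = <⇒≱ (≤-<-trans c<y y<c′) (row-stair-adjacent 2≤r 2≤c o o′)
      where
      2≤r : 2 ≤ r
      2≤r = proj₁ (on-stair 2≤c)
      c<y : c < y
      c<y = proj₂ (on-stair 2≤c)
      y<c′ : y < c′
      y<c′ = ≤∧≢⇒< (≮⇒≥ λ c′<y → outside (inj₂ (2≤r , c′<y))) (c′≢y ∘ sym)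

  LeftOrBefore-exit-vertical : y < h → Occupied r c → Occupied r′ c →
                               LeftOrBefore y r c → ¬ LeftOrBefore y r′ c → r′ < 1 × 1 < r
  LeftOrBefore-exit-vertical {y} {r} {c} {r′} y<h o o′ inside outside = ≰⇒> 1≰r′ , 2≤r
    where
    2<c : 2 < c
    2<c = ≰⇒> (outside ∘ inj₁)
    on-stair : 2 ≤ r × c < y
    on-stair = [ (λ c≤2 → ⊥-elim (<⇒≱ 2<c c≤2)) , id ]′ inside
    2≤r : 2 ≤ r
    2≤r = proj₁ on-stair
    c<y : c < y
    c<y = proj₂ on-stair
    1≰r′ : ¬ 1 ≤ r′
    1≰r′ 1≤r′ =
      <⇒≱ (<-trans c<y y<h) (≤-reflexive (sym (row1-right (subst (λ r → Occupied r c) r′≡1 o′) (<⇒≤ 2<c))))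
      where
      r′≡1 : r′ ≡ 1
      r′≡1 = ≤-antisym (s≤s⁻¹ (≰⇒> λ 2≤r′ → outside (inj₂ (2≤r′ , c<y)))) 1≤r′

  module Minimal {Q : Matrix} (Q-poly : IsPolyomino Q)
                 (f : Fin (rows Q) → Fin h) (g : Fin (cols Q) → Fin (suc h))
                 (f↑ : StrictlyIncreasing f) (g↑ : StrictlyIncreasing g)
                 (Q≗S : ∀ i j → entry Q i j ≡ entry snake (f i) (g j))
                 (M₀≼Q : M₀ ≼ Q) where

    row : Fin (rows Q) → ℕ
    row i = toℕ (f i)

    column : Fin (cols Q) → ℕ
    column j = toℕ (g j)

    occupied : ∀ {i j} → One Q (i , j) → Occupied (row i) (column j)
    occupied {i} {j} one = One⇒Occupied (trans (sym (Q≗S i j)) one)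

    One-over : ∀ {i j} → Occupied (row i) (column j) → One Q (i , j)
    One-over {i} {j} o = trans (Q≗S i j) (Occupied⇒One o)

    M₀-rows : Fin 2 → Fin (rows Q)
    M₀-rows = proj₁ M₀≼Q

    M₀-columns : Fin 4 → Fin (cols Q)
    M₀-columns = proj₁ (proj₂ M₀≼Q)

    Q≼snake : Q ≼ snake
    Q≼snake = f , g , f↑ , g↑ , Q≗S

    M₀≼Q≼snake : M₀ ≼ snake
    M₀≼Q≼snake = ≼-trans {M₀} {Q} {snake} M₀≼Q Q≼snake

    M₀-row : ∀ a → row (M₀-rows a) ≡ toℕ (standard-rows a)
    M₀-row a = cong toℕ (proj₁ (M₀-occurrence-unique M₀≼Q≼snake) a)

    M₀-column : ∀ b → column (M₀-columns b) ≡ toℕ (standard-columns b)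
    M₀-column b = cong toℕ (proj₂ (M₀-occurrence-unique M₀≼Q≼snake) b)

    last-M₀-column : column (M₀-columns (suc (suc (suc zero)))) ≡ h
    last-M₀-column = trans (M₀-column (suc (suc (suc zero)))) (toℕ-fromℕ h)

    -- Adjacent cells of Q never lie on both sides of the kept column 2 or row 1.
    confined : (R : ℕ → ℕ → Set) → (∀ r c → Dec (R r c)) →
               (∀ {i j j′} → One Q (i , j) → One Q (i , j′) →
                 R (row i) (column j) → ¬ R (row i) (column j′) → column j < 2 × 2 < column j′) →
               (∀ {i i′ j} → One Q (i , j) → One Q (i′ , j) →
                 R (row i) (column j) → ¬ R (row i′) (column j) → row i′ < 1 × 1 < row i) →
               R 0 0 → R 0 h
    confined R R? exit-horizontal exit-vertical R00 =
      subst₂ R (M₀-row zero) last-M₀-column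
        (Reach-preserves R-over closed start⇝end (subst₂ R (sym (M₀-row zero)) (sym (M₀-column zero)) R00))
      where
      start end : Cell Q
      start = M₀-rows zero , M₀-columns zero
      end = M₀-rows zero , M₀-columns (suc (suc (suc zero)))
      start-occupied : Occupied (row (proj₁ start)) (column (proj₂ start))
      start-occupied = subst₂ Occupied (sym (M₀-row zero)) (sym (M₀-column zero)) corner
      end-occupied : Occupied (row (proj₁ end)) (column (proj₂ end))
      end-occupied = subst₂ Occupied (sym (M₀-row zero)) (sym last-M₀-column) (top 3≤h)
      start⇝end : Reach Q start end
      start⇝end = IsPolyomino.connected Q-poly start end (One-over start-occupied) (One-over end-occupied)
      R-over : Cell Q → Set
      R-over (i , j) = R (row i) (column j)
      closed : ∀ {d e} → One Q d → One Q e → Adjacent Q d e → R-over d → R-over e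
      closed {_ , _} {_ , _} od oe (inj₁ (refl , j~j′)) Rd = decidable-stable (R? _ _) λ ¬Re →
        let (j<2 , 2<j′) = exit-horizontal od oe Rd ¬Re
        in  no-value-between g↑ (M₀-columns (suc (suc zero))) j~j′
              (subst (column _ <_) (sym (M₀-column (suc (suc zero)))) j<2)
              (subst (_< column _) (sym (M₀-column (suc (suc zero)))) 2<j′)
      closed {_ , _} {_ , _} od oe (inj₂ (refl , i~i′)) Rd = decidable-stable (R? _ _) λ ¬Re →
        let (i′<1 , 1<i) = exit-vertical od oe Rd ¬Re
        in  no-value-between f↑ (M₀-rows (suc zero)) (Neighbour-sym i~i′)
              (subst (row _ <_) (sym (M₀-row (suc zero))) i′<1)
              (subst (_< row _) (sym (M₀-row (suc zero))) 1<i)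

    every-row-kept : Onto f
    every-row-kept zero _ = M₀-rows zero , M₀-row zero
    every-row-kept (suc zero) _ = M₀-rows (suc zero) , M₀-row (suc zero)
    every-row-kept x@(suc (suc _)) x<h with any? (λ i → row i ≟ x)
    ... | yes kept = kept
    ... | no deleted = ⊥-elim (not-at-end (confined (LeftOrBelow x) (λ r c → c ≤? 2 ⊎-dec x <? r)
            (λ {i} oq oq′ →
              LeftOrBelow-exit-horizontal x<h (occupied oq) (occupied oq′) (λ e → deleted (i , e)))
            (λ {_} {i′} oq oq′ →
              LeftOrBelow-exit-vertical (s≤s (s≤s z≤n)) (occupied oq) (occupied oq′) (λ e → deleted (i′ , e)))
            (inj₁ z≤n)))
      where
      not-at-end : ¬ LeftOrBelow x 0 h
      not-at-end (inj₁ (s≤s (s≤s ())))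

    every-column-kept : Onto g
    every-column-kept zero _ = M₀-columns zero , M₀-column zero
    every-column-kept (suc zero) _ = M₀-columns (suc zero) , M₀-column (suc zero)
    every-column-kept (suc (suc zero)) _ = M₀-columns (suc (suc zero)) , M₀-column (suc (suc zero))
    every-column-kept y@(suc (suc (suc _))) y≤h with y ≟ h
    ... | yes refl = M₀-columns (suc (suc (suc zero))) , last-M₀-column
    ... | no y≢h with any? (λ j → column j ≟ y)
    ...   | yes kept = kept
    ...   | no deleted = ⊥-elim (not-at-end (confined (LeftOrBefore y)
            (λ r c → c ≤? 2 ⊎-dec (2 ≤? r ×-dec c <? y))
            (λ {_} {_} {j′} oq oq′ →
              LeftOrBefore-exit-horizontal (s≤s (s≤s (s≤s z≤n))) (occupied oq) (occupied oq′)
                                           (λ e → deleted (j′ , e)))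
            (λ oq oq′ → LeftOrBefore-exit-vertical (≤∧≢⇒< (s≤s⁻¹ y≤h) y≢h) (occupied oq) (occupied oq′))
            (inj₁ z≤n)))
      where
      not-at-end : ¬ LeftOrBefore y 0 h
      not-at-end (inj₁ (s≤s (s≤s ())))

    Q≡snake : Q ≡ snake
    Q≡snake = ≼-onto⇒≡ Q≼snake every-row-kept every-column-kept

  snake-minimal : ∀ Q → IsPolyomino Q → Q ≼ snake → ¬ (Q ≡ snake) → ¬ (M₀ ≼ Q)
  snake-minimal Q Q-poly (f , g , f↑ , g↑ , Q≗S) Q≢S M₀≼Q =
    Q≢S (Minimal.Q≡snake Q-poly f g f↑ g↑ Q≗S M₀≼Q)

  snake-in-p-basis : InPBasis M₀ snake
  snake-in-p-basis = snake-isPolyomino , M₀≼snake , snake-minimal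

mainTheorem11 : (N : ℕ) → ∃ λ (P : Matrix) → InPBasis M₀ P × N ≤ rows P + cols P
mainTheorem11 N = Snake.snake N , Snake.snake-in-p-basis N , ≤-trans (m≤n+m N 3) (m≤m+n (3 + N) _)
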